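{- Let $\mathcal{A}$ be an oracle sequential algorithm of sort $U,V,X,Y$ which terminates on a set $\mathcal{F}$ of functions $X\to Y$. Then for all $u\in U$ and $f\in\mathcal{F}$ there exists a finite sequence $x_0,\dots,x_{m-1}$ of elements of $X$ such that for every $g:X\to Y$, if $f(x_j)=g(x_j)$ for all $j<m$, then $\Phi_{\mathcal{A}}(u,g)$ is defined and $\Phi_{\mathcal{A}}(u,f)=\Phi_{\mathcal{A}}(u,g)$.
   Context: Oracle sequential algorithm (OSA) of sort $U,V,X,Y$: tuple $(R,Q,E,\rho,\xi,\pi,\rhd)$ where $R$ is a set of registers; states are pairs $\langle r\mid o\rangle$ with $r\in R$, $o\in Y\cup\{\Box\}$ ($\Box$ a fresh symbol); $Q\subseteq\{\langle r\mid\Box\rangle:r\in R\}$ (query states); $E$ a set of states (end states) with $Q\cap E=\emptyset$; $\rho:U\to R$; $\xi:R\to X$; $\pi$ a map from states to $V$; $\rhd$ a partial function from states to states. For an oracle $f:X\to Y$, a run on $f$ is a finite sequence of states $s_0,\dots,s_n$ with $s_i\notin E$ for $i<n$, $s_{i+1}=\langle r\mid f(\xi(r))\rangle$ if $s_i=\langle r\mid\Box\rangle\in Q$, and $s_{i+1}=\rhd(s_i)$ (defined) if $s_i\notin Q$; write $s\rhd^\ast_f t$. Let $\rho_u:=\langle\rho(u)\mid\Box\rangle$. $\Phi_{\mathcal{A}}(u,f):=\pi(t)$ if $\rho_u\rhd^\ast_f t\in E$, undefined otherwise. $\mathcal{A}$ terminates on $\mathcal{F}$ if for all $u\in U$, $f\in\mathcal{F}$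 there is $t\in E$ with $\rho_u\rhd^\ast_f t$. -}

module Defs where

open import Data.Maybe using (Maybe; just; nothing)
open import Data.Product using (Σ; ∃; _×_; _,_; proj₁; proj₂)
open import Data.Empty using (⊥)
open import Relation.Nullary using (¬_)
open import Relation.Binary.PropositionalEquality using (_≡_)

-- States are pairs ⟨ r ∣ o ⟩ with o ∈ Y ∪ {□}; we model Y ∪ {□} as Maybe Y,
-- with □ = nothing.
record OSA (U V X Y : Set) : Set₁ where
  field
    R   : Set
  State : Set
  State = R × Maybe Y
  field
    Q     : State → Set
    Q-box : ∀ s → Q s → proj₂ s ≡ nothing
    E     : State → Set
    Q∩E   : ∀ s → Q s → E s → ⊥
    ρ     : U → R
    ξ     : R → X
    π     : State → V
    ▷     : State → Maybe State

  ρ-st : U → State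
  ρ-st u = (ρ u , nothing)

  data Run (f : X → Y) : State → State → Set where
    done  : ∀ {s} → Run f s s
    query : ∀ {r t} → ¬ E (r , nothing) → Q (r , nothing)
          → Run f (r , just (f (ξ r))) t → Run f (r , nothing) t
    step  : ∀ {s s′ t} → ¬ E s → ¬ Q s → ▷ s ≡ just s′
          → Run f s′ t → Run f s t

  Φ≡ : U → (X → Y) → V → Set
  Φ≡ u f v = Σ State λ t → Run f (ρ-st u) t × E t × π t ≡ v

  Φ↓ : U → (X → Y) → Set
  Φ↓ u f = Σ V λ v → Φ≡ u f v

  Terminates : ((X → Y) → Set) → Set
  Terminates 𝓕 = ∀ (u : U) (f : X → Y) → 𝓕 f →
    Σ State λ t → Run f (ρ-st u) t × E t

-- A terminating run of A on an oracle f consults f at finitely many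
-- points only: the values ξ r at the query states it passes through.
-- Let xs be this list of queried points.  If g agrees with f on xs, the
-- very same sequence of states is a run on g (every query is answered
-- identically, every other step does not look at the oracle), so
-- Φ_A(u, g) is defined with the same end state.  Moreover runs are
-- deterministic: on a fixed oracle, a run from a given state can reach at
-- most one end state, because a run never passes through an end state and
-- each non-end state has at most one successor.  Hence Φ_A(u, –) is a
-- partial function, and the values on f and on g coincide.
module Submission where

open import Defs
open import Data.List using (List; []; _∷_)
open import Data.List.Membership.Propositional using (_∈_)
open import Data.List.Relation.Unary.Any using (here; there)
open import Data.Product using (Σ; _×_; _,_)
open import Data.Maybe using (just)
open import Data.Maybe.Properties using (just-injective)
open import Data.Empty using (⊥-elim)
open import Relation.Binary.PropositionalEquality
  using (_≡_; refl; sym; trans; cong; subst)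
open import Relation.Binary.PropositionalEquality.Properties
  using (module ≡-Reasoning)

module RunProperties {U V X Y : Set} (A : OSA U V X Y) where
  open OSA A

  queries : ∀ {f s t} → Run f s t → List X
  queries done                    = []
  queries (query {r = r} _ _ run) = ξ r ∷ queries run
  queries (step _ _ _ run)        = queries run

  -- A run on f is also a run on any g that agrees with f on the points the
  -- run queries: answers to queries are the only use made of the oracle.
  transport : ∀ {f g s t} (run : Run f s t)
            → (∀ x → x ∈ queries run → f x ≡ g x) → Run g s t
  transport done _ = done
  transport {g = g} {t = t} (query {r = r} ¬e q run) agree =
    query ¬e q (subst (λ y → Run g (r , just y) t) (agree (ξ r) (here refl))
                      (transport run (λ x x∈ → agree x (there x∈))))
  transport (step ¬e ¬q next run) agree = step ¬e ¬q next (transport run agree)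

  -- A run cannot
  -- continue past an end state, query states take no ▷-step, and ▷ is a
  -- partial function.
  end-unique : ∀ {h s t₁ t₂} → Run h s t₁ → E t₁ → Run h s t₂ → E t₂ → t₁ ≡ t₂
  end-unique done               _  done               _  = refl
  end-unique done               e₁ (query ¬e _ _)     _  = ⊥-elim (¬e e₁)
  end-unique done               e₁ (step ¬e _ _ _)    _  = ⊥-elim (¬e e₁)
  end-unique (query ¬e _ _)     _  done               e₂ = ⊥-elim (¬e e₂)
  end-unique (step ¬e _ _ _)    _  done               e₂ = ⊥-elim (¬e e₂)
  end-unique (query _ _ run₁)   e₁ (query _ _ run₂)   e₂ = end-unique run₁ e₁ run₂ e₂
  end-unique (query _ q _)      _  (step _ ¬q _ _)    _  = ⊥-elim (¬q q)
  end-unique (step _ ¬q _ _)    _  (query _ q _)      _  = ⊥-elim (¬q q)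
  end-unique (step _ _ next₁ run₁) e₁ (step _ _ next₂ run₂) e₂
    with just-injective (trans (sym next₁) next₂)
  ... | refl = end-unique run₁ e₁ run₂ e₂

  Φ-functional : ∀ {u h v w} → Φ≡ u h v → Φ≡ u h w → v ≡ w
  Φ-functional (t₁ , run₁ , e₁ , π₁) (t₂ , run₂ , e₂ , π₂) = begin
    _    ≡⟨ sym π₁ ⟩
    π t₁ ≡⟨ cong π (end-unique run₁ e₁ run₂ e₂) ⟩
    π t₂ ≡⟨ π₂ ⟩
    _    ∎
    where open ≡-Reasoning

proposition3p19 : {U V X Y : Set} (A : OSA U V X Y) (𝓕 : (X → Y) → Set)
    → OSA.Terminates A 𝓕
    → ∀ (u : U) (f : X → Y) → 𝓕 f
    → Σ (List X) λ xs → ∀ (g : X → Y) → (∀ x → x ∈ xs → f x ≡ g x)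
      → OSA.Φ↓ A u g
        × (∀ v w → OSA.Φ≡ A u f v → OSA.Φ≡ A u g w → v ≡ w)
proposition3p19 A 𝓕 terminates u f f∈𝓕
  with terminates u f f∈𝓕
... | t , run , end = queries run , λ g agree →
  let run-on-g = transport run agree
      Φf≡πt    = (t , run , end , refl)
      Φg≡πt    = (t , run-on-g , end , refl)
  in (π t , Φg≡πt) ,
     λ v w Φf≡v Φg≡w →
       trans (Φ-functional Φf≡v Φf≡πt) (Φ-functional Φg≡πt Φg≡w)
  where open OSA A
        open RunProperties A
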